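{- Let $f:\mathbb{F}_2^n\to\{ -1,1\}$ be a Boolean function with Fourier sparsity $k>4$. Then for every $\alpha\in\mathcal{S}$ there exists $\beta\in\mathcal{S}\setminus\{\alpha\}$ such that $|O_{\alpha+\beta}|\ge3$.
   Context: For $\alpha\in\mathbb{F}_2^n$ let $\chi_\alpha(x)=(-1)^{\sum_i\alpha_ix_i}$; every $f:\mathbb{F}_2^n\to\mathbb{R}$ is uniquely $f=\sum_\alpha\widehat f(\alpha)\chi_\alpha$. The Fourier support is $\mathcal{S}=\{\alpha:\widehat f(\alpha)\ne0\}$ and $k=|\mathcal{S}|$. For $\gamma\in\mathbb{F}_2^n$, $O_\gamma$ is the set of unordered pairs $\{\alpha_1,\alpha_2\}$ of distinct elements of $\mathcal{S}$ with $\alpha_1+\alpha_2=\gamma$ (addition in $\mathbb{F}_2^n$). -}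

module Defs where

open import Data.Nat using (ℕ; zero; suc)
open import Data.Bool using (Bool; true; false; _xor_; _∧_; if_then_else_)
import Data.Bool as B
open import Data.Vec using (Vec; []; _∷_; zipWith; foldr′)
import Data.Vec.Properties as VP
open import Data.List using (List; []; _∷_; map; _++_; filter; length; foldr)
open import Data.Integer using (ℤ; +_; -_; _*_)
import Data.Integer as Z
open import Relation.Nullary using (¬_; ¬?; _×-dec_)
open import Data.Product using (_×_; _,_; proj₁; proj₂)
open import Relation.Binary.PropositionalEquality using (_≡_)
open import Relation.Binary.Definitions using (DecidableEquality)

-- The vector space F_2^n, with Bool = F_2 (false = 0, true = 1).
F2^ : ℕ → Set
F2^ n = Vec Bool n

_≟v_ : ∀ {n} → DecidableEquality (F2^ n)
_≟v_ = VP.≡-dec B._≟_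

_⊕_ : ∀ {n} → F2^ n → F2^ n → F2^ n
_⊕_ = zipWith _xor_

allVecs : (n : ℕ) → List (F2^ n)
allVecs zero = [] ∷ []
allVecs (suc n) = map (false ∷_) (allVecs n) ++ map (true ∷_) (allVecs n)

dot : ∀ {n} → F2^ n → F2^ n → Bool
dot α x = foldr′ _xor_ false (zipWith _∧_ α x)

χ : ∀ {n} → F2^ n → F2^ n → ℤ
χ α x = if dot α x then Z.-[1+ 0 ] else + 1

-- 2^n · f̂(α) = Σ_x f(x) χ_α(x).  (Scaled by the nonzero constant 2^n so it
-- stays in ℤ; only whether it is zero matters below.)
scaledCoeff : ∀ {n} → (F2^ n → ℤ) → F2^ n → ℤ
scaledCoeff {n} f α = foldr Z._+_ (+ 0) (map (λ x → f x * χ α x) (allVecs n))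

InSupport : ∀ {n} → (F2^ n → ℤ) → F2^ n → Set
InSupport f α = ¬ (scaledCoeff f α ≡ + 0)

support : ∀ {n} → (F2^ n → ℤ) → List (F2^ n)
support {n} f = filter (λ α → ¬? (scaledCoeff f α Z.≟ + 0)) (allVecs n)

sparsity : ∀ {n} → (F2^ n → ℤ) → ℕ
sparsity f = length (support f)

-- unordered pairs {a,b} of a list: a occurs before b
pairs : ∀ {A : Set} → List A → List (A × A)
pairs [] = []
pairs (a ∷ l) = map (a ,_) l ++ pairs l

O-size : ∀ {n} → (F2^ n → ℤ) → F2^ n → ℕ
O-size f γ = length (filter
  (λ p → ¬? (proj₁ p ≟v proj₂ p) ×-dec ((proj₁ p ⊕ proj₂ p) ≟v γ))
  (pairs (support f)))

module Submission where

-- Write F = 2ⁿ f̂, A = F α, and suppose |O_{α⊕β}| ≤ 2 for every β ∈ S ∖ {α}. As f² = 1, the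
-- autocorrelation Σ_y F y F (y ⊕ γ) vanishes for γ ≠ 0. At γ = α ⊕ β its nonzero terms sit at the
-- elements of the pairs of O_γ, so besides {α, β} there is exactly one more pair {c, d}, and
-- A F β + F c F d = 0. For x ∈ S ∖ {α} with second pair {c, d}, the pairs {x, d} ∈ O_{α⊕c} and
-- {x, c} ∈ O_{α⊕d} give two more such relations, whence F x² = A². Pairing x with the element of
-- {c, d} where F takes the value A is a perfect matching of {x ∈ S ∖ {α} : F x = A}, so F = A at
-- an odd number 2q + 1 of points. Then σ = Σ_S F / A = 4q + 2 - k satisfies σ² = k (Parseval) and
-- σ ∣ 2ⁿ (inversion at 0); as σ² + σ ≡ 2 (mod 4), 4 ∤ σ, so |σ| ≤ 2 and k ≤ 4.

open import Defs
open import Data.Nat as ℕ using (ℕ; zero; suc; _^_; _≤_; _<_; s≤s; z≤n)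
import Data.Nat.Properties as ℕ
open import Data.Nat.Divisibility using (_∣_; divides; ∣⇒≤; ∣1⇒≡1; ∣-trans; m∣m*n; _∣?_)
open import Data.Nat.Coprimality using (Coprime; coprime-divisor)
open import Data.Nat.Primality using (irreducible[2])
open import Data.Integer as ℤ using (ℤ; +_; -[1+_]; _+_; _*_; -_; _-_; ∣_∣)
import Data.Integer.Properties as ℤ
open import Data.Integer.Divisibility.Signed as ℤ∣
  using (∣ᵤ⇒∣; ∣⇒∣ᵤ; ∣m∣n⇒∣m+n; ∣m+n∣m⇒∣n; ∣n⇒∣m*n; ∣m⇒∣m*n)
open import Data.Integer.Tactic.RingSolver using (solve-∀)
open import Data.Bool using (Bool; true; false; _xor_; _∧_)
import Data.Bool.Properties as Bool
open import Data.Vec using ([]; _∷_; replicate)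
import Data.Vec.Properties as Vec
open import Data.Vec.Relation.Binary.Pointwise.Inductive
  using (zipWith-comm; zipWith-assoc; zipWith-identityʳ; Pointwise-≡⇒≡)
open import Data.List using (List; []; _∷_; map; _++_; foldr; filter; length)
import Data.List.Properties as List
open import Data.List.Membership.Propositional using (_∈_; _∉_; lose)
open import Data.List.Membership.Propositional.Properties
  using (∈-++⁺ˡ; ∈-++⁺ʳ; ∈-map⁺; ∈-map⁻; ∈-filter⁺; ∈-filter⁻)
open import Data.List.Membership.DecPropositional using () renaming (_∈?_ to ∈?)
open import Data.List.Relation.Unary.Any using (here; there; any?; satisfied)
open import Data.List.Relation.Unary.All using ([]; _∷_)
import Data.List.Relation.Unary.All as All
open import Data.List.Relation.Unary.AllPairs using ([]; _∷_)
open import Data.List.Relation.Unary.Unique.Propositional using (Unique)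
import Data.List.Relation.Unary.Unique.Propositional.Properties as Unique
open import Data.Product using (Σ; ∃; _×_; _,_; proj₁; proj₂)
open import Data.Sum using (_⊎_; inj₁; inj₂)
open import Data.Empty using (⊥; ⊥-elim)
open import Function using (_∘_)
open import Relation.Nullary using (¬_; Dec; yes; no; ¬?; _×-dec_; contradiction)
open import Relation.Unary using (Decidable)
open import Relation.Binary.Definitions using (DecidableEquality)
open import Relation.Binary.PropositionalEquality
open ≡-Reasoning

-- Sums over lists

∑ : {A : Set} → List A → (A → ℤ) → ℤ
∑ xs g = foldr _+_ (+ 0) (map g xs)

module _ {A : Set} where

  ∑-++ : (xs ys : List A) (g : A → ℤ) → ∑ (xs ++ ys) g ≡ ∑ xs g + ∑ ys g
  ∑-++ [] ys g = sym (ℤ.+-identityˡ _)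
  ∑-++ (x ∷ xs) ys g = trans (cong (_+_ (g x)) (∑-++ xs ys g)) (sym (ℤ.+-assoc (g x) _ _))

  ∑-map : {B : Set} (h : B → A) (xs : List B) (g : A → ℤ) → ∑ (map h xs) g ≡ ∑ xs (λ x → g (h x))
  ∑-map h [] g = refl
  ∑-map h (x ∷ xs) g = cong (_+_ (g (h x))) (∑-map h xs g)

  ∑-cong : (xs : List A) {g h : A → ℤ} → (∀ x → g x ≡ h x) → ∑ xs g ≡ ∑ xs h
  ∑-cong [] e = refl
  ∑-cong (x ∷ xs) e = cong₂ _+_ (e x) (∑-cong xs e)

  ∑-cong-∈ : (xs : List A) {g h : A → ℤ} → (∀ {x} → x ∈ xs → g x ≡ h x) → ∑ xs g ≡ ∑ xs h
  ∑-cong-∈ [] e = refl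
  ∑-cong-∈ (x ∷ xs) e = cong₂ _+_ (e (here refl)) (∑-cong-∈ xs (λ m → e (there m)))

  ∑-zero : (xs : List A) → ∑ xs (λ _ → + 0) ≡ + 0
  ∑-zero [] = refl
  ∑-zero (x ∷ xs) = trans (ℤ.+-identityˡ _) (∑-zero xs)

  ∑-const : (xs : List A) (c : ℤ) → ∑ xs (λ _ → c) ≡ + length xs * c
  ∑-const [] c = refl
  ∑-const (x ∷ xs) c = begin
    c + ∑ xs (λ _ → c)       ≡⟨ cong (_+_ c) (∑-const xs c) ⟩
    c + + length xs * c      ≡⟨ lemma c (+ length xs) ⟩
    (+ 1 + + length xs) * c  ≡⟨ cong (_* c) (sym (ℤ.pos-+ 1 (length xs))) ⟩
    + length (x ∷ xs) * c    ∎
    where lemma : ∀ c l → c + l * c ≡ (+ 1 + l) * c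
          lemma = solve-∀

  ∑-+ : (xs : List A) (g h : A → ℤ) → ∑ xs (λ x → g x + h x) ≡ ∑ xs g + ∑ xs h
  ∑-+ [] g h = refl
  ∑-+ (x ∷ xs) g h = trans (cong (_+_ (g x + h x)) (∑-+ xs g h)) (lemma (g x) (h x) _ _)
    where lemma : ∀ a b c d → (a + b) + (c + d) ≡ (a + c) + (b + d)
          lemma = solve-∀

  ∑-*ˡ : (c : ℤ) (xs : List A) (g : A → ℤ) → c * ∑ xs g ≡ ∑ xs (λ x → c * g x)
  ∑-*ˡ c [] g = ℤ.*-zeroʳ c
  ∑-*ˡ c (x ∷ xs) g = trans (ℤ.*-distribˡ-+ c (g x) _) (cong (_+_ (c * g x)) (∑-*ˡ c xs g))

  ∑-±value : ∀ (xs : List A) (g : A → ℤ) a → (∀ {x} → x ∈ xs → g x ≡ a ⊎ g x ≡ - a) →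
    ∑ xs g ≡ a * (+ 2 * + length (filter (λ x → g x ℤ.≟ a) xs) - + length xs)
  ∑-±value [] g a _ = sym (ℤ.*-zeroʳ a)
  ∑-±value (x ∷ xs) g a ± with g x ℤ.≟ a | ± (here refl)
  ... | yes gx≡a | _ = begin
    g x + ∑ xs g
      ≡⟨ cong₂ _+_ gx≡a (∑-±value xs g a (λ m → ± (there m))) ⟩
    a + a * (+ 2 * + p - + l)
      ≡⟨ lemma a (+ p) (+ l) ⟩
    a * (+ 2 * (+ 1 + + p) - (+ 1 + + l))
      ≡⟨ cong₂ (λ u v → a * (+ 2 * u - v)) (sym (ℤ.pos-+ 1 p)) (sym (ℤ.pos-+ 1 l)) ⟩
    a * (+ 2 * + suc p - + suc l) ∎
    where
    p = length (filter (λ x → g x ℤ.≟ a) xs)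
    l = length xs
    lemma : ∀ a p l → a + a * (+ 2 * p - l) ≡ a * (+ 2 * (+ 1 + p) - (+ 1 + l))
    lemma = solve-∀
  ... | no gx≢a | inj₁ gx≡a = ⊥-elim (gx≢a gx≡a)
  ... | no _    | inj₂ gx≡-a = begin
    g x + ∑ xs g                               ≡⟨ cong₂ _+_ gx≡-a (∑-±value xs g a (λ m → ± (there m))) ⟩
    - a + a * (+ 2 * + p - + l)                ≡⟨ lemma a (+ p) (+ l) ⟩
    a * (+ 2 * + p - (+ 1 + + l))              ≡⟨ cong (λ v → a * (+ 2 * + p - v)) (sym (ℤ.pos-+ 1 l)) ⟩
    a * (+ 2 * + p - + suc l)                  ∎
    where
    p = length (filter (λ x → g x ℤ.≟ a) xs)
    l = length xs
    lemma : ∀ a p l → - a + a * (+ 2 * p - l) ≡ a * (+ 2 * p - (+ 1 + l))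
    lemma = solve-∀

∑-swap : {A B : Set} (xs : List A) (ys : List B) (g : A → B → ℤ) →
  ∑ xs (λ x → ∑ ys (g x)) ≡ ∑ ys (λ y → ∑ xs (λ x → g x y))
∑-swap [] ys g = sym (∑-zero ys)
∑-swap (x ∷ xs) ys g =
  trans (cong (_+_ (∑ ys (g x))) (∑-swap xs ys g)) (sym (∑-+ ys (g x) (λ y → ∑ xs (λ x → g x y))))

∑-product : {A B : Set} (xs : List A) (ys : List B) (g : A → ℤ) (h : B → ℤ) →
  ∑ xs g * ∑ ys h ≡ ∑ xs (λ x → ∑ ys (λ y → g x * h y))
∑-product xs ys g h = begin
  ∑ xs g * ∑ ys h                    ≡⟨ ℤ.*-comm (∑ xs g) (∑ ys h) ⟩
  ∑ ys h * ∑ xs g                    ≡⟨ ∑-*ˡ (∑ ys h) xs g ⟩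
  ∑ xs (λ x → ∑ ys h * g x)          ≡⟨ ∑-cong xs (λ x → trans (ℤ.*-comm (∑ ys h) (g x)) (∑-*ˡ (g x) ys h)) ⟩
  ∑ xs (λ x → ∑ ys (λ y → g x * h y)) ∎

𝟙 : {P : Set} → Dec P → ℤ
𝟙 (yes _) = + 1
𝟙 (no _)  = + 0

module Sifting {A : Set} (_≟_ : DecidableEquality A) where

  𝟙-sym : ∀ x y → 𝟙 (x ≟ y) ≡ 𝟙 (y ≟ x)
  𝟙-sym x y with x ≟ y | y ≟ x
  ... | yes _   | yes _   = refl
  ... | no _    | no _    = refl
  ... | yes x≡y | no y≢x  = ⊥-elim (y≢x (sym x≡y))
  ... | no x≢y  | yes y≡x = ⊥-elim (x≢y (sym y≡x))

  ∑-sift-∉ : ∀ {x} xs (g : A → ℤ) → x ∉ xs → ∑ xs (λ y → 𝟙 (x ≟ y) * g y) ≡ + 0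
  ∑-sift-∉ [] g x∉ = refl
  ∑-sift-∉ {x} (y ∷ xs) g x∉ with x ≟ y
  ... | yes x≡y = ⊥-elim (x∉ (here x≡y))
  ... | no _    = trans (cong (_+ ∑ xs (λ y → 𝟙 (x ≟ y) * g y)) (ℤ.*-zeroˡ (g y)))
                      (trans (ℤ.+-identityˡ _) (∑-sift-∉ xs g (λ x∈ → x∉ (there x∈))))

  ∑-sift : ∀ {x} xs (g : A → ℤ) → Unique xs → x ∈ xs → ∑ xs (λ y → 𝟙 (x ≟ y) * g y) ≡ g x
  ∑-sift {x} (y ∷ xs) g (y∉xs ∷ u) x∈ with x ≟ y | x∈
  ... | yes refl | _ = begin
    + 1 * g x + ∑ xs (λ y → 𝟙 (x ≟ y) * g y) ≡⟨ cong₂ _+_ (ℤ.*-identityˡ (g x))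
                                                   (∑-sift-∉ xs g (λ x∈ → All.lookup y∉xs x∈ refl)) ⟩
    g x + + 0                                ≡⟨ ℤ.+-identityʳ (g x) ⟩
    g x                                      ∎
  ... | no x≢y | here x≡y = ⊥-elim (x≢y x≡y)
  ... | no _   | there x∈xs = trans (cong (_+ ∑ xs (λ y → 𝟙 (x ≟ y) * g y)) (ℤ.*-zeroˡ (g y)))
                                 (trans (ℤ.+-identityˡ _) (∑-sift xs g u x∈xs))

  ∑-restrict : ∀ xs ys (g : A → ℤ) → Unique xs → Unique ys → (∀ {y} → y ∈ ys → y ∈ xs) →
               (∀ x → x ∉ ys → g x ≡ + 0) → ∑ xs g ≡ ∑ ys g
  ∑-restrict xs ys g uxs uys ys⊆xs g-off = begin
    ∑ xs g
      ≡⟨ ∑-cong xs sifted ⟩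
    ∑ xs (λ x → ∑ ys (λ y → 𝟙 (x ≟ y) * g y))
      ≡⟨ ∑-swap xs ys _ ⟩
    ∑ ys (λ y → ∑ xs (λ x → 𝟙 (x ≟ y) * g y))
      ≡⟨ ∑-cong ys (λ y → ∑-cong xs (λ x → cong (_* g y) (𝟙-sym x y))) ⟩
    ∑ ys (λ y → ∑ xs (λ x → 𝟙 (y ≟ x) * g y))
      ≡⟨ ∑-cong-∈ ys (λ y∈ → ∑-sift xs _ uxs (ys⊆xs y∈)) ⟩
    ∑ ys g ∎
    where
    sifted : ∀ x → g x ≡ ∑ ys (λ y → 𝟙 (x ≟ y) * g y)
    sifted x with ∈? _≟_ x ys
    ... | yes x∈ = sym (∑-sift ys g uys x∈)
    ... | no x∉  = trans (g-off x x∉) (sym (∑-sift-∉ ys g x∉))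

-- The group F₂ⁿ

0ᵛ : ∀ {n} → F2^ n
0ᵛ = replicate _ false

⊕-comm : ∀ {n} (x y : F2^ n) → x ⊕ y ≡ y ⊕ x
⊕-comm x y = Pointwise-≡⇒≡ (zipWith-comm Bool.xor-comm x y)

⊕-assoc : ∀ {n} (x y z : F2^ n) → (x ⊕ y) ⊕ z ≡ x ⊕ (y ⊕ z)
⊕-assoc x y z = Pointwise-≡⇒≡ (zipWith-assoc Bool.xor-assoc x y z)

⊕-identityʳ : ∀ {n} (x : F2^ n) → x ⊕ 0ᵛ ≡ x
⊕-identityʳ x = Pointwise-≡⇒≡ (zipWith-identityʳ Bool.xor-identityʳ x)

⊕-identityˡ : ∀ {n} (x : F2^ n) → 0ᵛ ⊕ x ≡ x
⊕-identityˡ x = trans (⊕-comm 0ᵛ x) (⊕-identityʳ x)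

⊕-self : ∀ {n} (x : F2^ n) → x ⊕ x ≡ 0ᵛ
⊕-self [] = refl
⊕-self (a ∷ x) = cong₂ _∷_ (Bool.xor-same a) (⊕-self x)

⊕-cancelˡ : ∀ {n} (x y : F2^ n) → x ⊕ (x ⊕ y) ≡ y
⊕-cancelˡ x y = begin
  x ⊕ (x ⊕ y) ≡⟨ sym (⊕-assoc x x y) ⟩
  (x ⊕ x) ⊕ y ≡⟨ cong (_⊕ y) (⊕-self x) ⟩
  0ᵛ ⊕ y      ≡⟨ ⊕-identityˡ y ⟩
  y           ∎

⊕-cancelʳ : ∀ {n} (x y : F2^ n) → (x ⊕ y) ⊕ y ≡ x
⊕-cancelʳ x y = trans (⊕-comm (x ⊕ y) y) (trans (cong (y ⊕_) (⊕-comm x y)) (⊕-cancelˡ y x))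

⊕-injectiveʳ : ∀ {n} (x : F2^ n) {y z} → x ⊕ y ≡ x ⊕ z → y ≡ z
⊕-injectiveʳ x {y} {z} e = trans (sym (⊕-cancelˡ x y)) (trans (cong (x ⊕_) e) (⊕-cancelˡ x z))

⊕≡0⇒≡ : ∀ {n} {x y : F2^ n} → x ⊕ y ≡ 0ᵛ → x ≡ y
⊕≡0⇒≡ {x = x} {y} e = sym (⊕-injectiveʳ x (trans e (sym (⊕-self x))))

allVecs-complete : ∀ n (x : F2^ n) → x ∈ allVecs n
allVecs-complete zero    []        = here refl
allVecs-complete (suc n) (false ∷ x) = ∈-++⁺ˡ (∈-map⁺ (false ∷_) (allVecs-complete n x))
allVecs-complete (suc n) (true ∷ x)  =
  ∈-++⁺ʳ (map (false ∷_) (allVecs n)) (∈-map⁺ (true ∷_) (allVecs-complete n x))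

allVecs-unique : ∀ n → Unique (allVecs n)
allVecs-unique zero    = [] ∷ []
allVecs-unique (suc n) =
  Unique.++⁺ (Unique.map⁺ Vec.∷-injectiveʳ (allVecs-unique n))
             (Unique.map⁺ Vec.∷-injectiveʳ (allVecs-unique n)) disjoint
  where
  disjoint : ∀ {v} → ¬ (v ∈ map (false ∷_) (allVecs n) × v ∈ map (true ∷_) (allVecs n))
  disjoint (p , q) with ∈-map⁻ (false ∷_) p | ∈-map⁻ (true ∷_) q
  ... | _ , _ , refl | _ , _ , ()

search : ∀ {n} {Q : F2^ n → Set} → Decidable Q → ∃ Q ⊎ (∀ x → ¬ Q x)
search {n} Q? with any? Q? (allVecs n)
... | yes q = inj₁ (satisfied q)
... | no ¬q = inj₂ (λ x qx → ¬q (lose (allVecs-complete n x) qx))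

vanishes-off-or-witness : ∀ {n} (g : F2^ n → ℤ) (P : List (F2^ n)) →
  (∀ y → y ∉ P → g y ≡ + 0) ⊎ ∃ λ y → y ∉ P × ¬ g y ≡ + 0
vanishes-off-or-witness g P with search (λ y → ¬? (∈? _≟v_ y P) ×-dec ¬? (g y ℤ.≟ + 0))
... | inj₁ witness = inj₂ witness
... | inj₂ none    = inj₁ vanishes
  where
  vanishes : ∀ y → y ∉ P → g y ≡ + 0
  vanishes y y∉ with g y ℤ.≟ + 0
  ... | yes gy≡0 = gy≡0
  ... | no gy≢0  = ⊥-elim (none y (y∉ , gy≢0))

∑-allVecs-suc : ∀ n (g : F2^ (suc n) → ℤ) →
  ∑ (allVecs (suc n)) g ≡ ∑ (allVecs n) (λ x → g (false ∷ x)) + ∑ (allVecs n) (λ x → g (true ∷ x))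
∑-allVecs-suc n g = trans (∑-++ (map (false ∷_) (allVecs n)) _ g)
  (cong₂ _+_ (∑-map (false ∷_) (allVecs n) g) (∑-map (true ∷_) (allVecs n) g))

⊕-moveʳ : ∀ {n} {x g z : F2^ n} → x ⊕ g ≡ z → x ≡ z ⊕ g
⊕-moveʳ {x = x} {g} refl = sym (⊕-cancelʳ x g)

⊕-moveˡ : ∀ {n} {x y z : F2^ n} → x ⊕ y ≡ z → y ≡ x ⊕ z
⊕-moveˡ {x = x} {y} refl = sym (⊕-cancelˡ x y)

⊕-≢ˡ : ∀ {n} {a b c : F2^ n} → ¬ c ≡ b → ¬ c ⊕ (a ⊕ b) ≡ a
⊕-≢ˡ {a = a} {b} c≢b e = c≢b (trans (⊕-moveʳ e) (⊕-cancelˡ a b))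

⊕-≢ʳ : ∀ {n} {a b c : F2^ n} → ¬ c ≡ a → ¬ c ⊕ (a ⊕ b) ≡ b
⊕-≢ʳ {a = a} {b} c≢a e = ⊕-≢ˡ c≢a (trans (cong (_ ⊕_) (⊕-comm b a)) e)

≢⇒⊕-≢ : ∀ {n} {a b : F2^ n} x → ¬ a ≡ b → ¬ x ≡ x ⊕ (a ⊕ b)
≢⇒⊕-≢ x a≢b e = a≢b (⊕≡0⇒≡ (sym (⊕-injectiveʳ x (trans (⊕-identityʳ x) e))))

⊕-exchange : ∀ {n} {a b c d : F2^ n} → a ⊕ b ≡ c ⊕ d → a ⊕ c ≡ b ⊕ d
⊕-exchange {a = a} {b} {c} {d} e = begin
  a ⊕ c               ≡⟨ cong (_⊕ c) (⊕-moveˡ (trans (⊕-comm b a) e)) ⟩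
  (b ⊕ (c ⊕ d)) ⊕ c   ≡⟨ ⊕-assoc b (c ⊕ d) c ⟩
  b ⊕ ((c ⊕ d) ⊕ c)   ≡⟨ cong (b ⊕_) (trans (⊕-comm (c ⊕ d) c) (⊕-cancelˡ c d)) ⟩
  b ⊕ d               ∎

⊕-rotate : ∀ {n} (x a y : F2^ n) → y ⊕ (a ⊕ x) ≡ x ⊕ (a ⊕ y)
⊕-rotate x a y = begin
  y ⊕ (a ⊕ x)   ≡⟨ cong (y ⊕_) (⊕-comm a x) ⟩
  y ⊕ (x ⊕ a)   ≡⟨ sym (⊕-assoc y x a) ⟩
  (y ⊕ x) ⊕ a   ≡⟨ cong (_⊕ a) (⊕-comm y x) ⟩
  (x ⊕ y) ⊕ a   ≡⟨ ⊕-assoc x y a ⟩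
  x ⊕ (y ⊕ a)   ≡⟨ cong (x ⊕_) (⊕-comm y a) ⟩
  x ⊕ (a ⊕ y)   ∎

-- Characters and the Fourier transform

sgn : Bool → ℤ
sgn false = + 1
sgn true  = -[1+ 0 ]

sgn-xor : ∀ a b → sgn (a xor b) ≡ sgn a * sgn b
sgn-xor false b     = sym (ℤ.*-identityˡ (sgn b))
sgn-xor true  false = refl
sgn-xor true  true  = refl

χ≡sgn∘dot : ∀ {n} (a x : F2^ n) → χ a x ≡ sgn (dot a x)
χ≡sgn∘dot a x with dot a x
... | true  = refl
... | false = refl

χ-∷ : ∀ {n} a (α : F2^ n) x xs → χ (a ∷ α) (x ∷ xs) ≡ sgn (a ∧ x) * χ α xs
χ-∷ a α x xs = begin
  χ (a ∷ α) (x ∷ xs)             ≡⟨ χ≡sgn∘dot (a ∷ α) (x ∷ xs) ⟩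
  sgn ((a ∧ x) xor dot α xs)     ≡⟨ sgn-xor (a ∧ x) (dot α xs) ⟩
  sgn (a ∧ x) * sgn (dot α xs)   ≡⟨ cong (sgn (a ∧ x) *_) (sym (χ≡sgn∘dot α xs)) ⟩
  sgn (a ∧ x) * χ α xs           ∎

χ-comm : ∀ {n} (a x : F2^ n) → χ a x ≡ χ x a
χ-comm []      []       = refl
χ-comm (a ∷ α) (x ∷ xs) = begin
  χ (a ∷ α) (x ∷ xs)    ≡⟨ χ-∷ a α x xs ⟩
  sgn (a ∧ x) * χ α xs  ≡⟨ cong₂ _*_ (cong sgn (Bool.∧-comm a x)) (χ-comm α xs) ⟩
  sgn (x ∧ a) * χ xs α  ≡⟨ sym (χ-∷ x xs a α) ⟩
  χ (x ∷ xs) (a ∷ α)    ∎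

χ-⊕ˡ : ∀ {n} (a b x : F2^ n) → χ (a ⊕ b) x ≡ χ a x * χ b x
χ-⊕ˡ []      []      []       = refl
χ-⊕ˡ (a ∷ α) (b ∷ β) (x ∷ xs) = begin
  χ ((a xor b) ∷ (α ⊕ β)) (x ∷ xs)
    ≡⟨ χ-∷ (a xor b) (α ⊕ β) x xs ⟩
  sgn ((a xor b) ∧ x) * χ (α ⊕ β) xs
    ≡⟨ cong₂ _*_ (cong sgn (Bool.∧-distribʳ-xor x a b)) (χ-⊕ˡ α β xs) ⟩
  sgn ((a ∧ x) xor (b ∧ x)) * (χ α xs * χ β xs)
    ≡⟨ cong (_* (χ α xs * χ β xs)) (sgn-xor (a ∧ x) (b ∧ x)) ⟩
  (sgn (a ∧ x) * sgn (b ∧ x)) * (χ α xs * χ β xs)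
    ≡⟨ lemma (sgn (a ∧ x)) (sgn (b ∧ x)) (χ α xs) (χ β xs) ⟩
  (sgn (a ∧ x) * χ α xs) * (sgn (b ∧ x) * χ β xs)
    ≡⟨ sym (cong₂ _*_ (χ-∷ a α x xs) (χ-∷ b β x xs)) ⟩
  χ (a ∷ α) (x ∷ xs) * χ (b ∷ β) (x ∷ xs) ∎
  where lemma : ∀ p q r s → (p * q) * (r * s) ≡ (p * r) * (q * s)
        lemma = solve-∀

χ-⊕ʳ : ∀ {n} (a x y : F2^ n) → χ a (x ⊕ y) ≡ χ a x * χ a y
χ-⊕ʳ a x y = begin
  χ a (x ⊕ y)     ≡⟨ χ-comm a (x ⊕ y) ⟩
  χ (x ⊕ y) a     ≡⟨ χ-⊕ˡ x y a ⟩
  χ x a * χ y a   ≡⟨ cong₂ _*_ (χ-comm x a) (χ-comm y a) ⟩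
  χ a x * χ a y   ∎

pow2 : ℕ → ℤ
pow2 n = + (2 ^ n)

-- 2ⁿ times the indicator of w = 0
δ₀ : ∀ {n} → F2^ n → ℤ
δ₀ []          = + 1
δ₀ (false ∷ w) = + 2 * δ₀ w
δ₀ (true ∷ w)  = + 0

δ₀-0ᵛ : ∀ n → δ₀ (0ᵛ {n}) ≡ pow2 n
δ₀-0ᵛ zero    = refl
δ₀-0ᵛ (suc n) = trans (cong (+ 2 *_) (δ₀-0ᵛ n)) (sym (ℤ.pos-* 2 (2 ^ n)))

δ₀-≢0ᵛ : ∀ {n} (w : F2^ n) → ¬ w ≡ 0ᵛ → δ₀ w ≡ + 0
δ₀-≢0ᵛ []          w≢0 = ⊥-elim (w≢0 refl)
δ₀-≢0ᵛ (false ∷ w) w≢0 = cong (+ 2 *_) (δ₀-≢0ᵛ w (λ w≡0 → w≢0 (cong (false ∷_) w≡0)))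
δ₀-≢0ᵛ (true ∷ w)  w≢0 = refl

δ₀-⊕ : ∀ {n} (x z : F2^ n) → δ₀ (x ⊕ z) ≡ pow2 n * 𝟙 (x ≟v z)
δ₀-⊕ {n} x z with x ≟v z
... | yes refl = trans (cong δ₀ (⊕-self x)) (trans (δ₀-0ᵛ n) (sym (ℤ.*-identityʳ (pow2 n))))
... | no x≢z   = trans (δ₀-≢0ᵛ (x ⊕ z) (λ e → x≢z (⊕≡0⇒≡ e))) (sym (ℤ.*-zeroʳ (pow2 n)))

orthogonality : ∀ n (w : F2^ n) → ∑ (allVecs n) (λ y → χ y w) ≡ δ₀ w
orthogonality zero    []       = refl
orthogonality (suc n) (c ∷ w) = begin
  ∑ (allVecs (suc n)) (λ y → χ y (c ∷ w))
    ≡⟨ ∑-allVecs-suc n (λ y → χ y (c ∷ w)) ⟩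
  ∑ V (λ y → χ (false ∷ y) (c ∷ w)) + ∑ V (λ y → χ (true ∷ y) (c ∷ w))
    ≡⟨ cong₂ _+_ (∑-cong V (λ y → trans (χ-∷ false y c w) (ℤ.*-identityˡ (χ y w))))
                 (trans (∑-cong V (λ y → χ-∷ true y c w)) (sym (∑-*ˡ (sgn c) V (λ y → χ y w)))) ⟩
  ∑ V (λ y → χ y w) + sgn c * ∑ V (λ y → χ y w)
    ≡⟨ cong (λ t → t + sgn c * t) (orthogonality n w) ⟩
  δ₀ w + sgn c * δ₀ w
    ≡⟨ combine c ⟩
  δ₀ (c ∷ w) ∎
  where
  V = allVecs n
  combine : ∀ c → δ₀ w + sgn c * δ₀ w ≡ δ₀ (c ∷ w)
  combine false = lemma (δ₀ w)
    where lemma : ∀ t → t + + 1 * t ≡ + 2 * t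
          lemma = solve-∀
  combine true  = lemma (δ₀ w)
    where lemma : ∀ t → t + -[1+ 0 ] * t ≡ + 0
          lemma = solve-∀

∑-δ₀ : ∀ {n} (x : F2^ n) (g : F2^ n → ℤ) → ∑ (allVecs n) (λ z → δ₀ (x ⊕ z) * g z) ≡ pow2 n * g x
∑-δ₀ {n} x g = begin
  ∑ V (λ z → δ₀ (x ⊕ z) * g z)
    ≡⟨ ∑-cong V (λ z → trans (cong (_* g z) (δ₀-⊕ x z)) (ℤ.*-assoc (pow2 n) _ (g z))) ⟩
  ∑ V (λ z → pow2 n * (𝟙 (x ≟v z) * g z))
    ≡⟨ sym (∑-*ˡ (pow2 n) V _) ⟩
  pow2 n * ∑ V (λ z → 𝟙 (x ≟v z) * g z)
    ≡⟨ cong (pow2 n *_) (Sifting.∑-sift _≟v_ V g (allVecs-unique n) (allVecs-complete n x)) ⟩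
  pow2 n * g x ∎
  where V = allVecs n

fourier-inversion : ∀ {n} (f : F2^ n → ℤ) → ∑ (allVecs n) (scaledCoeff f) ≡ pow2 n * f 0ᵛ
fourier-inversion {n} f = begin
  ∑ V (λ y → ∑ V (λ x → f x * χ y x))
    ≡⟨ ∑-swap V V (λ y x → f x * χ y x) ⟩
  ∑ V (λ x → ∑ V (λ y → f x * χ y x))
    ≡⟨ ∑-cong V (λ x → sym (∑-*ˡ (f x) V (λ y → χ y x))) ⟩
  ∑ V (λ x → f x * ∑ V (λ y → χ y x))
    ≡⟨ ∑-cong V (λ x → cong (f x *_) (orthogonality n x)) ⟩
  ∑ V (λ x → f x * δ₀ x)
    ≡⟨ ∑-cong V (λ x → trans (ℤ.*-comm (f x) (δ₀ x)) (cong (λ w → δ₀ w * f x) (sym (⊕-identityˡ x)))) ⟩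
  ∑ V (λ x → δ₀ (0ᵛ ⊕ x) * f x)
    ≡⟨ ∑-δ₀ 0ᵛ f ⟩
  pow2 n * f 0ᵛ ∎
  where V = allVecs n

autocorrelation : ∀ {n} (f : F2^ n → ℤ) → (∀ x → f x * f x ≡ + 1) → ∀ γ →
  ∑ (allVecs n) (λ y → scaledCoeff f y * scaledCoeff f (y ⊕ γ)) ≡ pow2 n * δ₀ γ
autocorrelation {n} f f²≡1 γ = begin
  ∑ V (λ y → F y * F (y ⊕ γ))
    ≡⟨ ∑-cong V expand ⟩
  ∑ V (λ y → ∑ V (λ x → ∑ V (λ z → G x z * χ y (x ⊕ z))))
    ≡⟨ ∑-swap V V _ ⟩
  ∑ V (λ x → ∑ V (λ y → ∑ V (λ z → G x z * χ y (x ⊕ z))))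
    ≡⟨ ∑-cong V (λ x → ∑-swap V V _) ⟩
  ∑ V (λ x → ∑ V (λ z → ∑ V (λ y → G x z * χ y (x ⊕ z))))
    ≡⟨ ∑-cong V (λ x → ∑-cong V (λ z → sym (∑-*ˡ (G x z) V _))) ⟩
  ∑ V (λ x → ∑ V (λ z → G x z * ∑ V (λ y → χ y (x ⊕ z))))
    ≡⟨ ∑-cong V (λ x → ∑-cong V (λ z → cong (G x z *_) (orthogonality n (x ⊕ z)))) ⟩
  ∑ V (λ x → ∑ V (λ z → G x z * δ₀ (x ⊕ z)))
    ≡⟨ ∑-cong V (λ x → trans (∑-cong V (λ z → ℤ.*-comm (G x z) _)) (∑-δ₀ x (G x))) ⟩
  ∑ V (λ x → pow2 n * G x x)
    ≡⟨ sym (∑-*ˡ (pow2 n) V (λ x → G x x)) ⟩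
  pow2 n * ∑ V (λ x → G x x)
    ≡⟨ cong (pow2 n *_) (∑-cong V diagonal) ⟩
  pow2 n * ∑ V (λ x → χ x γ)
    ≡⟨ cong (pow2 n *_) (orthogonality n γ) ⟩
  pow2 n * δ₀ γ ∎
  where
  V = allVecs n
  F = scaledCoeff f
  G : F2^ _ → F2^ _ → ℤ
  G x z = f x * f z * χ γ z
  expand : ∀ y → F y * F (y ⊕ γ) ≡ ∑ V (λ x → ∑ V (λ z → G x z * χ y (x ⊕ z)))
  expand y = trans (∑-product V V _ _) (∑-cong V (λ x → ∑-cong V (λ z → regroup x z)))
    where
    regroup : ∀ x z → (f x * χ y x) * (f z * χ (y ⊕ γ) z) ≡ G x z * χ y (x ⊕ z)
    regroup x z rewrite χ-⊕ˡ y γ z | χ-⊕ʳ y x z = lemma (f x) (f z) (χ y x) (χ y z) (χ γ z)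
      where lemma : ∀ a b c d e → (a * c) * (b * (d * e)) ≡ (a * b * e) * (c * d)
            lemma = solve-∀
  diagonal : ∀ x → G x x ≡ χ x γ
  diagonal x = trans (cong (_* χ γ x) (f²≡1 x)) (trans (ℤ.*-identityˡ (χ γ x)) (χ-comm γ x))

-- Counting in lists

module _ {A : Set} where

  1≤length : ∀ {x : A} {xs} → x ∈ xs → 1 ≤ length xs
  1≤length (here _)  = s≤s z≤n
  1≤length (there _) = s≤s z≤n

  2≤length : ∀ {x y : A} {xs} → x ∈ xs → y ∈ xs → ¬ x ≡ y → 2 ≤ length xs
  2≤length (here refl) (here refl) x≢y = ⊥-elim (x≢y refl)
  2≤length (here refl) (there y∈) _    = s≤s (1≤length y∈)
  2≤length (there x∈) (here refl) _    = s≤s (1≤length x∈)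
  2≤length (there x∈) (there y∈) x≢y   = ℕ.m≤n⇒m≤1+n (2≤length x∈ y∈ x≢y)

  3≤length : ∀ {x y z : A} {xs} → x ∈ xs → y ∈ xs → z ∈ xs →
             ¬ x ≡ y → ¬ x ≡ z → ¬ y ≡ z → 3 ≤ length xs
  3≤length (here refl) (here refl) _           x≢y _   _   = ⊥-elim (x≢y refl)
  3≤length (here refl) (there _)  (here refl)  _   x≢z _   = ⊥-elim (x≢z refl)
  3≤length (there _)   (here refl) (here refl) _   _   y≢z = ⊥-elim (y≢z refl)
  3≤length (here refl) (there y∈) (there z∈)   _   _   y≢z = s≤s (2≤length y∈ z∈ y≢z)
  3≤length (there x∈)  (here refl) (there z∈)  _   x≢z _   = s≤s (2≤length x∈ z∈ x≢z)
  3≤length (there x∈)  (there y∈) (here refl)  x≢y _   _   = s≤s (2≤length x∈ y∈ x≢y)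
  3≤length (there x∈)  (there y∈) (there z∈) x≢y x≢z y≢z = ℕ.m≤n⇒m≤1+n (3≤length x∈ y∈ z∈ x≢y x≢z y≢z)

  pairs-∈ : ∀ {a b : A} xs → a ∈ xs → b ∈ xs → ¬ a ≡ b → (a , b) ∈ pairs xs ⊎ (b , a) ∈ pairs xs
  pairs-∈ (x ∷ xs) (here refl) (here refl) a≢b = ⊥-elim (a≢b refl)
  pairs-∈ (x ∷ xs) (here refl) (there b∈) _    = inj₁ (∈-++⁺ˡ (∈-map⁺ (x ,_) b∈))
  pairs-∈ (x ∷ xs) (there a∈) (here refl) _    = inj₂ (∈-++⁺ˡ (∈-map⁺ (x ,_) a∈))
  pairs-∈ (x ∷ xs) (there a∈) (there b∈) a≢b with pairs-∈ xs a∈ b∈ a≢b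
  ... | inj₁ p = inj₁ (∈-++⁺ʳ (map (x ,_) xs) p)
  ... | inj₂ p = inj₂ (∈-++⁺ʳ (map (x ,_) xs) p)

module _ {A : Set} (_≟_ : DecidableEquality A) where

  length-filter-≢ : ∀ {y} xs → Unique xs → y ∈ xs →
                    length xs ≡ suc (length (filter (λ z → ¬? (z ≟ y)) xs))
  length-filter-≢ (x ∷ xs) (x∉xs ∷ _) (here refl) with x ≟ x
  ... | no x≢x = ⊥-elim (x≢x refl)
  ... | yes _  = cong (suc ∘ length) (sym (List.filter-all (λ z → ¬? (z ≟ x)) (All.map ≢-sym x∉xs)))
  length-filter-≢ {y} (x ∷ xs) (x∉xs ∷ u) (there y∈) with x ≟ y
  ... | yes refl = ⊥-elim (All.lookup x∉xs y∈ refl)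
  ... | no _     = cong suc (length-filter-≢ xs u y∈)

  record PerfectMatching (R : A → A → Set) (xs : List A) : Set where
    field
      partner     : ∀ {x} → x ∈ xs → ∃ λ y → y ∈ xs × R x y
      functional  : ∀ {x y y′} → x ∈ xs → y ∈ xs → y′ ∈ xs → R x y → R x y′ → y ≡ y′
      symmetric   : ∀ {x y} → x ∈ xs → y ∈ xs → R x y → R y x
      irreflexive : ∀ {x} → ¬ R x x

  module _ {R : A → A → Set} where

    matching-delete : ∀ {x y xs} → Unique (x ∷ xs) → PerfectMatching R (x ∷ xs) →
      y ∈ x ∷ xs → R x y → PerfectMatching R (filter (λ z → ¬? (z ≟ y)) xs)
    matching-delete {x} {y} {xs} (x∉xs ∷ _) M y∈ Rxy = record
      { partner     = partner′
      ; functional  = λ z∈ w∈ w′∈ → functional (⊆ z∈) (⊆ w∈) (⊆ w′∈)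
      ; symmetric   = λ z∈ w∈ → symmetric (⊆ z∈) (⊆ w∈)
      ; irreflexive = irreflexive
      }
      where
      open PerfectMatching M
      ≢y? = λ z → ¬? (z ≟ y)
      ⊆ : ∀ {z} → z ∈ filter ≢y? xs → z ∈ x ∷ xs
      ⊆ z∈ = there (proj₁ (∈-filter⁻ ≢y? z∈))
      partner′ : ∀ {z} → z ∈ filter ≢y? xs → ∃ λ w → w ∈ filter ≢y? xs × R z w
      partner′ {z} z∈ with partner (⊆ z∈) | ∈-filter⁻ ≢y? {xs = xs} z∈
      ... | w , here refl , Rzx | _ , z≢y =
        ⊥-elim (z≢y (functional (here refl) (⊆ z∈) y∈ (symmetric (⊆ z∈) (here refl) Rzx) Rxy))
      ... | w , there w∈xs , Rzw | z∈xs , _ = w , ∈-filter⁺ ≢y? w∈xs w≢y , Rzw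
        where
        w≢y : ¬ w ≡ y
        w≢y refl = All.lookup x∉xs z∈xs
          (functional y∈ (here refl) (⊆ z∈) (symmetric (here refl) y∈ Rxy) (symmetric (⊆ z∈) y∈ Rzw))

    even-length : ∀ xs → Unique xs → PerfectMatching R xs → ∃ λ q → length xs ≡ q ℕ.+ q
    even-length xs = go (length xs) xs ℕ.≤-refl
      where
      go : ∀ fuel xs → length xs ≤ fuel → Unique xs → PerfectMatching R xs → ∃ λ q → length xs ≡ q ℕ.+ q
      go _ [] _ _ _ = 0 , refl
      go (suc fuel) (x ∷ xs) (s≤s len≤) u@(_ ∷ uxs) M with PerfectMatching.partner M (here refl)
      ... | y , here refl , Rxx = ⊥-elim (PerfectMatching.irreflexive M Rxx)
      ... | y , y∈@(there y∈xs) , Rxy = suc q , cong suc (trans len (trans (cong suc even) (sym (ℕ.+-suc q q))))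
        where
        rest = filter (λ z → ¬? (z ≟ y)) xs
        len : length xs ≡ suc (length rest)
        len = length-filter-≢ xs uxs y∈xs
        ih = go fuel rest (ℕ.≤-trans (ℕ.n≤1+n _) (subst (_≤ fuel) len len≤))
                (Unique.filter⁺ (λ z → ¬? (z ≟ y)) uxs) (matching-delete u M y∈ Rxy)
        q = proj₁ ih
        even = proj₂ ih

-- Arithmetic

odd⇒coprime-2 : ∀ {e} → ¬ 2 ∣ e → Coprime e 2
odd⇒coprime-2 2∤e (d∣e , d∣2) with irreducible[2] d∣2
... | inj₁ d≡1  = d≡1
... | inj₂ refl = contradiction d∣e 2∤e

odd∣2^n⇒≡1 : ∀ n {e} → ¬ 2 ∣ e → e ∣ 2 ^ n → e ≡ 1
odd∣2^n⇒≡1 zero    _   e∣1 = ∣1⇒≡1 e∣1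
odd∣2^n⇒≡1 (suc n) 2∤e e∣2^1+n = odd∣2^n⇒≡1 n 2∤e (coprime-divisor (odd⇒coprime-2 2∤e) e∣2^1+n)

∣2^n∧4∤⇒≤2 : ∀ n {d} → d ∣ 2 ^ n → ¬ 4 ∣ d → d ≤ 2
∣2^n∧4∤⇒≤2 n {d} d∣2^n 4∤d with 2 ∣? d
... | no 2∤d = ℕ.≤-trans (ℕ.≤-reflexive (odd∣2^n⇒≡1 n 2∤d d∣2^n)) (ℕ.n≤1+n 1)
... | yes (divides e refl) = ℕ.≤-reflexive (cong (ℕ._* 2) (odd∣2^n⇒≡1 n 2∤e (∣-trans (m∣m*n 2) d∣2^n)))
  where
  2∤e : ¬ 2 ∣ e
  2∤e (divides g refl) = 4∤d (divides g (ℕ.*-assoc g 2 2))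

*-≢0 : ∀ {a b} → ¬ a ≡ + 0 → ¬ b ≡ + 0 → ¬ a * b ≡ + 0
*-≢0 {a} a≢0 b≢0 ab≡0 with ℤ.i*j≡0⇒i≡0∨j≡0 a ab≡0
... | inj₁ a≡0 = a≢0 a≡0
... | inj₂ b≡0 = b≢0 b≡0

+≡0⇒≡- : ∀ a b → a + b ≡ + 0 → a ≡ - b
+≡0⇒≡- a b e = begin
  a             ≡⟨ lemma a b ⟩
  (a + b) - b   ≡⟨ cong (_- b) e ⟩
  + 0 - b       ≡⟨ ℤ.+-identityˡ (- b) ⟩
  - b           ∎
  where lemma : ∀ a b → a ≡ (a + b) - b
        lemma = solve-∀

t+t≡0⇒t≡0 : ∀ t → t + t ≡ + 0 → t ≡ + 0
t+t≡0⇒t≡0 t e = ℤ.*-cancelˡ-≡ (+ 2) t (+ 0) (trans (lemma t) e)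
  where lemma : ∀ t → + 2 * t ≡ t + t
        lemma = solve-∀

x²≡a²⇒x≡±a : ∀ x a → x * x ≡ a * a → x ≡ a ⊎ x ≡ - a
x²≡a²⇒x≡±a x a e
  with ℤ.i*j≡0⇒i≡0∨j≡0 (x - a) (trans (lemma x a) (trans (cong (_- a * a) e) (ℤ.+-inverseʳ (a * a))))
  where lemma : ∀ x a → (x - a) * (x + a) ≡ x * x - a * a
        lemma = solve-∀
... | inj₁ x-a≡0 = inj₁ (trans (+≡0⇒≡- x (- a) x-a≡0) (ℤ.neg-involutive a))
... | inj₂ x+a≡0 = inj₂ (+≡0⇒≡- x a x+a≡0)

squares-balance : ∀ a x c d → ¬ c * d ≡ + 0 → a * c + x * d ≡ + 0 → a * d + x * c ≡ + 0 → x * x ≡ a * a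
squares-balance a x c d cd≢0 e₁ e₂ = ℤ.*-cancelʳ-≡ (x * x) (a * a) (c * d) {{ℤ.≢-nonZero cd≢0}} (begin
  (x * x) * (c * d)         ≡⟨ l₁ x c d ⟩
  (- (x * d)) * (- (x * c)) ≡⟨ sym (cong₂ _*_ (+≡0⇒≡- (a * c) (x * d) e₁) (+≡0⇒≡- (a * d) (x * c) e₂)) ⟩
  (a * c) * (a * d)         ≡⟨ l₂ a c d ⟩
  (a * a) * (c * d)         ∎)
  where
  l₁ : ∀ x c d → (x * x) * (c * d) ≡ (- (x * d)) * (- (x * c))
  l₁ = solve-∀
  l₂ : ∀ a c d → (a * c) * (a * d) ≡ (a * a) * (c * d)
  l₂ = solve-∀

σ²+σ≡4q+2⇒4∤σ : ∀ σ q → σ * σ + σ ≡ + 4 * + q + + 2 → ¬ 4 ∣ ∣ σ ∣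
σ²+σ≡4q+2⇒4∤σ σ q eq 4∣∣σ∣ = contradiction (∣⇒≤ {2} {4} (∣⇒∣ᵤ 4∣2)) λ { (ℕ.s≤s (ℕ.s≤s ())) }
  where
  4∣σ : + 4 ℤ∣.∣ σ
  4∣σ = ∣ᵤ⇒∣ 4∣∣σ∣
  4∣2 : + 4 ℤ∣.∣ + 2
  4∣2 = ∣m+n∣m⇒∣n (subst (+ 4 ℤ∣.∣_) eq (∣m∣n⇒∣m+n (∣n⇒∣m*n σ 4∣σ) 4∣σ)) (∣m⇒∣m*n (+ q) ℤ∣.∣-refl)

k≤4 : ∀ n k q (a σ s : ℤ) → ¬ a ≡ + 0 → s * s ≡ + 1 → a * σ ≡ pow2 n * s →
  + k * (a * a) ≡ pow2 n * pow2 n → σ + + k ≡ + 4 * + q + + 2 → k ≤ 4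
k≤4 n k q a σ s a≢0 s²≡1 aσ≡2ⁿs ka²≡2²ⁿ σ+k≡4q+2 =
  ℕ.≤-trans (ℕ.≤-reflexive (trans (cong ∣_∣ (sym σ²≡k)) (ℤ.abs-* σ σ))) (ℕ.*-mono-≤ ∣σ∣≤2 ∣σ∣≤2)
  where
  P = pow2 n
  a≠0 = ℤ.≢-nonZero a≢0
  σ²≡k : σ * σ ≡ + k
  σ²≡k = ℤ.*-cancelˡ-≡ (a * a) (σ * σ) (+ k) {{ℤ.i*j≢0 a a {{a≠0}} {{a≠0}}}} (begin
    (a * a) * (σ * σ) ≡⟨ l₁ a σ ⟩
    (a * σ) * (a * σ) ≡⟨ cong₂ _*_ aσ≡2ⁿs aσ≡2ⁿs ⟩
    (P * s) * (P * s) ≡⟨ l₂ P s ⟩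
    (P * P) * (s * s) ≡⟨ trans (cong ((P * P) *_) s²≡1) (ℤ.*-identityʳ (P * P)) ⟩
    P * P             ≡⟨ trans (sym ka²≡2²ⁿ) (ℤ.*-comm (+ k) (a * a)) ⟩
    (a * a) * + k     ∎)
    where
    l₁ : ∀ a σ → (a * a) * (σ * σ) ≡ (a * σ) * (a * σ)
    l₁ = solve-∀
    l₂ : ∀ P s → (P * s) * (P * s) ≡ (P * P) * (s * s)
    l₂ = solve-∀
  ∣s∣≡1 : ∣ s ∣ ≡ 1
  ∣s∣≡1 = ℕ.m*n≡1⇒m≡1 ∣ s ∣ ∣ s ∣ (trans (sym (ℤ.abs-* s s)) (cong ∣_∣ s²≡1))
  ∣σ∣∣2ⁿ : ∣ σ ∣ ∣ 2 ^ n
  ∣σ∣∣2ⁿ = divides ∣ a ∣ (begin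
    2 ^ n             ≡⟨ sym (ℕ.*-identityʳ (2 ^ n)) ⟩
    2 ^ n ℕ.* 1       ≡⟨ cong (2 ^ n ℕ.*_) (sym ∣s∣≡1) ⟩
    ∣ P ∣ ℕ.* ∣ s ∣   ≡⟨ sym (ℤ.abs-* P s) ⟩
    ∣ P * s ∣         ≡⟨ cong ∣_∣ (sym aσ≡2ⁿs) ⟩
    ∣ a * σ ∣         ≡⟨ ℤ.abs-* a σ ⟩
    ∣ a ∣ ℕ.* ∣ σ ∣   ∎)
  ∣σ∣≤2 : ∣ σ ∣ ≤ 2
  ∣σ∣≤2 = ∣2^n∧4∤⇒≤2 n ∣σ∣∣2ⁿ
    (σ²+σ≡4q+2⇒4∤σ σ q (trans (cong (_+ σ) σ²≡k) (trans (ℤ.+-comm (+ k) σ) σ+k≡4q+2)))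

module Support {n} (f : F2^ n → ℤ) where

  S : List (F2^ n)
  S = support f

  private
    S? : ∀ a → Dec (InSupport f a)
    S? a = ¬? (scaledCoeff f a ℤ.≟ + 0)

  ∈S⁺ : ∀ {a} → InSupport f a → a ∈ S
  ∈S⁺ {a} a∈S = ∈-filter⁺ S? (allVecs-complete n a) a∈S

  ∈S⁻ : ∀ {a} → a ∈ S → InSupport f a
  ∈S⁻ a∈ = proj₂ (∈-filter⁻ S? {xs = allVecs n} a∈)

  S-unique : Unique S
  S-unique = Unique.filter⁺ S? (allVecs-unique n)

  ∑-support : (g : F2^ n → ℤ) → (∀ x → scaledCoeff f x ≡ + 0 → g x ≡ + 0) → ∑ (allVecs n) g ≡ ∑ S g
  ∑-support g g-off = Sifting.∑-restrict _≟v_ (allVecs n) S g (allVecs-unique n) S-unique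
    (λ {y} _ → allVecs-complete n y) off
    where
    off : ∀ x → x ∉ S → g x ≡ + 0
    off x x∉S with scaledCoeff f x ℤ.≟ + 0
    ... | yes Fx≡0 = g-off x Fx≡0
    ... | no Fx≢0  = ⊥-elim (x∉S (∈S⁺ Fx≢0))

  InO : F2^ n → F2^ n → F2^ n → Set
  InO γ a b = InSupport f a × InSupport f b × ¬ a ≡ b × a ⊕ b ≡ γ

  private
    O? : ∀ γ (p : F2^ n × F2^ n) → Dec (¬ proj₁ p ≡ proj₂ p × proj₁ p ⊕ proj₂ p ≡ γ)
    O? γ p = ¬? (proj₁ p ≟v proj₂ p) ×-dec ((proj₁ p ⊕ proj₂ p) ≟v γ)

    Orientation : F2^ n → F2^ n → F2^ n × F2^ n → Set
    Orientation a b p = p ≡ (a , b) ⊎ p ≡ (b , a)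

    entry : ∀ {γ a b} → InO γ a b → ∃ λ p → p ∈ filter (O? γ) (pairs S) × Orientation a b p
    entry {γ} {a} {b} (a∈S , b∈S , a≢b , a⊕b≡γ) with pairs-∈ S (∈S⁺ a∈S) (∈S⁺ b∈S) a≢b
    ... | inj₁ ab∈ = (a , b) , ∈-filter⁺ (O? γ) ab∈ (a≢b , a⊕b≡γ) , inj₁ refl
    ... | inj₂ ba∈ = (b , a) , ∈-filter⁺ (O? γ) ba∈ (≢-sym a≢b , trans (⊕-comm b a) a⊕b≡γ) , inj₂ refl

    entries-differ : ∀ {a b u v p p′} → Orientation a b p → Orientation u v p′ → ¬ u ≡ a → ¬ u ≡ b → ¬ p ≡ p′
    entries-differ (inj₁ refl) (inj₁ refl) u≢a _ e = u≢a (sym (cong proj₁ e))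
    entries-differ (inj₂ refl) (inj₁ refl) _ u≢b e = u≢b (sym (cong proj₁ e))
    entries-differ (inj₁ refl) (inj₂ refl) _ u≢b e = u≢b (sym (cong proj₂ e))
    entries-differ (inj₂ refl) (inj₂ refl) u≢a _ e = u≢a (sym (cong proj₂ e))

  three-pairs⇒3≤O-size : ∀ {γ a b c d e h} → InO γ a b → InO γ c d → InO γ e h →
    ¬ c ≡ a → ¬ c ≡ b → ¬ e ≡ a → ¬ e ≡ b → ¬ e ≡ c → ¬ e ≡ d → 3 ≤ O-size f γ
  three-pairs⇒3≤O-size ab cd eh c≢a c≢b e≢a e≢b e≢c e≢d
    with entry ab | entry cd | entry eh
  ... | _ , p∈ , p↔ | _ , p′∈ , p′↔ | _ , p″∈ , p″↔ = 3≤length p∈ p′∈ p″∈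
    (entries-differ p↔ p′↔ c≢a c≢b) (entries-differ p↔ p″↔ e≢a e≢b) (entries-differ p′↔ p″↔ e≢c e≢d)

module BoundedO {n} (f : F2^ n → ℤ) (f²≡1 : ∀ x → f x * f x ≡ + 1)
  (α : F2^ n) (α∈S : InSupport f α)
  (O≤2 : ∀ β → InSupport f β → ¬ β ≡ α → O-size f (α ⊕ β) ≤ 2) where

  open Support f

  F : F2^ n → ℤ
  F = scaledCoeff f

  A : ℤ
  A = F α

  V : List (F2^ n)
  V = allVecs n

  T : F2^ n → F2^ n → ℤ
  T γ y = F y * F (y ⊕ γ)

  T≢0⇒∈S : ∀ γ y → ¬ T γ y ≡ + 0 → InSupport f y × InSupport f (y ⊕ γ)
  T≢0⇒∈S γ y Tγy≢0 = (λ Fy≡0 → Tγy≢0 (cong (_* F (y ⊕ γ)) Fy≡0))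
                        , (λ Fy⊕γ≡0 → Tγy≢0 (trans (cong (F y *_) Fy⊕γ≡0) (ℤ.*-zeroʳ (F y))))

  ∑T≡0 : ∀ {β} → ¬ α ≡ β → ∑ V (T (α ⊕ β)) ≡ + 0
  ∑T≡0 {β} α≢β = begin
    ∑ V (T (α ⊕ β))        ≡⟨ autocorrelation f f²≡1 (α ⊕ β) ⟩
    pow2 n * δ₀ (α ⊕ β)    ≡⟨ cong (pow2 n *_) (δ₀-≢0ᵛ (α ⊕ β) (λ e → α≢β (⊕≡0⇒≡ e))) ⟩
    pow2 n * + 0           ≡⟨ ℤ.*-zeroʳ (pow2 n) ⟩
    + 0                    ∎

  ∑T-over : ∀ {γ} P → Unique P → (∀ y → y ∉ P → T γ y ≡ + 0) → ∑ V (T γ) ≡ ∑ P (T γ)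
  ∑T-over {γ} P uP = Sifting.∑-restrict _≟v_ V P (T γ) (allVecs-unique n) uP (λ {y} _ → allVecs-complete n y)

  T-α : ∀ β → T (α ⊕ β) α ≡ A * F β
  T-α β = cong (λ t → A * F t) (⊕-cancelˡ α β)

  T-β : ∀ β → T (α ⊕ β) β ≡ A * F β
  T-β β = trans (cong (λ t → F β * F t) (trans (cong (β ⊕_) (⊕-comm α β)) (⊕-cancelˡ β α))) (ℤ.*-comm (F β) A)

  -- O_{α⊕β} = {{α, β}, {c, c ⊕ (α ⊕ β)}}
  record SecondPair (β : F2^ n) : Set where
    field
      c       : F2^ n
      c≢α     : ¬ c ≡ α
      c≢β     : ¬ c ≡ β
      c∈S     : InSupport f c
      d∈S     : InSupport f (c ⊕ (α ⊕ β))
      only    : ∀ y → ¬ T (α ⊕ β) y ≡ + 0 → y ∈ α ∷ β ∷ c ∷ c ⊕ (α ⊕ β) ∷ []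
      balance : A * F β + F c * F (c ⊕ (α ⊕ β)) ≡ + 0

    d : F2^ n
    d = c ⊕ (α ⊕ β)

    d≢α : ¬ d ≡ α
    d≢α = ⊕-≢ˡ c≢β

    d≢β : ¬ d ≡ β
    d≢β = ⊕-≢ʳ c≢α

    c⊕d≡α⊕β : c ⊕ d ≡ α ⊕ β
    c⊕d≡α⊕β = ⊕-cancelˡ c (α ⊕ β)

  module _ {β} (β∈S : InSupport f β) (β≢α : ¬ β ≡ α) where
    private
      γ = α ⊕ β
      α≢β : ¬ α ≡ β
      α≢β = ≢-sym β≢α

    pair-at : ∀ y → ¬ T γ y ≡ + 0 → InO γ y (y ⊕ γ)
    pair-at y Tγy≢0 = proj₁ (T≢0⇒∈S γ y Tγy≢0) , proj₂ (T≢0⇒∈S γ y Tγy≢0) , ≢⇒⊕-≢ y α≢β , ⊕-cancelˡ y γ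

    no-third-pair : ∀ {c e} → ¬ c ≡ α → ¬ c ≡ β → ¬ T γ c ≡ + 0 → ¬ T γ e ≡ + 0 →
      e ∉ α ∷ β ∷ c ∷ c ⊕ γ ∷ [] → ⊥
    no-third-pair {c} {e} c≢α c≢β Tγc≢0 Tγe≢0 e∉ = ℕ.<⇒≱
      (three-pairs⇒3≤O-size (α∈S , β∈S , α≢β , refl) (pair-at c Tγc≢0) (pair-at e Tγe≢0) c≢α c≢β
        (λ e≡ → e∉ (here e≡)) (λ e≡ → e∉ (there (here e≡)))
        (λ e≡ → e∉ (there (there (here e≡)))) (λ e≡ → e∉ (there (there (there (here e≡))))))
      (O≤2 β β∈S β≢α)

    second-pair-from : ∀ c → ¬ c ≡ α → ¬ c ≡ β → ¬ T γ c ≡ + 0 → SecondPair β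
    second-pair-from c c≢α c≢β Tγc≢0 with vanishes-off-or-witness (T γ) (α ∷ β ∷ c ∷ c ⊕ γ ∷ [])
    ... | inj₂ (e , e∉ , Tγe≢0) = ⊥-elim (no-third-pair c≢α c≢β Tγc≢0 Tγe≢0 e∉)
    ... | inj₁ vanishes = record
      { c = c ; c≢α = c≢α ; c≢β = c≢β
      ; c∈S = proj₁ (T≢0⇒∈S γ c Tγc≢0) ; d∈S = proj₂ (T≢0⇒∈S γ c Tγc≢0)
      ; only = only ; balance = balance }
      where
      d = c ⊕ γ
      P = α ∷ β ∷ c ∷ d ∷ []
      P-unique : Unique P
      P-unique = (α≢β ∷ ≢-sym c≢α ∷ ≢-sym (⊕-≢ˡ c≢β) ∷ []) ∷ (≢-sym c≢β ∷ ≢-sym (⊕-≢ʳ c≢α) ∷ [])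
               ∷ (≢⇒⊕-≢ c α≢β ∷ []) ∷ [] ∷ []
      only : ∀ y → ¬ T γ y ≡ + 0 → y ∈ P
      only y Tγy≢0 with ∈? _≟v_ y P
      ... | yes y∈P = y∈P
      ... | no y∉P  = ⊥-elim (Tγy≢0 (vanishes y y∉P))
      T-d : T γ d ≡ F c * F d
      T-d = trans (cong (λ t → F d * F t) (⊕-cancelʳ c γ)) (ℤ.*-comm (F d) (F c))
      four-terms : ∑ P (T γ) ≡ A * F β + (A * F β + (F c * F d + (F c * F d + + 0)))
      four-terms = cong₂ _+_ (T-α β) (cong₂ _+_ (T-β β) (cong (_+_ (F c * F d)) (cong (_+ + 0) T-d)))
      balance : A * F β + F c * F d ≡ + 0
      balance = t+t≡0⇒t≡0 _ (begin
        (A * F β + F c * F d) + (A * F β + F c * F d)            ≡⟨ lemma (A * F β) (F c * F d) ⟩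
        A * F β + (A * F β + (F c * F d + (F c * F d + + 0)))    ≡⟨ sym four-terms ⟩
        ∑ P (T γ)                                                ≡⟨ sym (∑T-over P P-unique vanishes) ⟩
        ∑ V (T γ)                                                ≡⟨ ∑T≡0 α≢β ⟩
        + 0                                                      ∎)
        where lemma : ∀ p q → (p + q) + (p + q) ≡ p + (p + (q + (q + + 0)))
              lemma = solve-∀

    -- The autocorrelation at γ vanishes, so {α, β} cannot be the only pair in O_γ.
    second-pair : SecondPair β
    second-pair with vanishes-off-or-witness (T γ) (α ∷ β ∷ [])
    ... | inj₂ (c , c∉ , Tγc≢0) = second-pair-from c (λ c≡ → c∉ (here c≡)) (λ c≡ → c∉ (there (here c≡))) Tγc≢0
    ... | inj₁ vanishes = ⊥-elim (*-≢0 α∈S β∈S (t+t≡0⇒t≡0 _ (begin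
      A * F β + A * F β              ≡⟨ cong₂ _+_ (sym (T-α β)) (trans (sym (T-β β)) (sym (ℤ.+-identityʳ _))) ⟩
      ∑ (α ∷ β ∷ []) (T γ)           ≡⟨ sym (∑T-over (α ∷ β ∷ []) ((α≢β ∷ []) ∷ [] ∷ []) vanishes) ⟩
      ∑ V (T γ)                      ≡⟨ ∑T≡0 α≢β ⟩
      + 0                            ∎)))

  pair-balance : ∀ {z} → InSupport f z → ¬ z ≡ α → ∀ {u w} → InSupport f u → InSupport f w →
    u ⊕ w ≡ α ⊕ z → ¬ u ≡ α → ¬ u ≡ z → A * F z + F u * F w ≡ + 0
  pair-balance {z} z∈S z≢α {u} {w} u∈S w∈S u⊕w≡α⊕z u≢α u≢z =
    from-membership (only u (*-≢0 u∈S (subst (InSupport f) w≡u⊕γ w∈S)))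
    where
    open SecondPair (second-pair z∈S z≢α)
    γ = α ⊕ z
    w≡u⊕γ : w ≡ u ⊕ γ
    w≡u⊕γ = ⊕-moveˡ u⊕w≡α⊕z
    from-membership : u ∈ α ∷ z ∷ c ∷ d ∷ [] → A * F z + F u * F w ≡ + 0
    from-membership (here u≡α)                       = ⊥-elim (u≢α u≡α)
    from-membership (there (here u≡z))               = ⊥-elim (u≢z u≡z)
    from-membership (there (there (here u≡c)))        = trans (cong (_+_ (A * F z)) uw≡cd) balance
      where
      uw≡cd : F u * F w ≡ F c * F d
      uw≡cd = cong₂ (λ a b → F a * F b) u≡c (trans w≡u⊕γ (cong (_⊕ γ) u≡c))
    from-membership (there (there (there (here u≡d)))) = trans (cong (_+_ (A * F z)) uw≡cd) balance
      where
      uw≡cd : F u * F w ≡ F c * F d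
      uw≡cd = trans (cong₂ (λ a b → F a * F b) u≡d (trans w≡u⊕γ (trans (cong (_⊕ γ) u≡d) (⊕-cancelʳ c γ))))
                    (ℤ.*-comm (F d) (F c))

  F²≡A² : ∀ x → InSupport f x → F x * F x ≡ A * A
  F²≡A² x x∈S with x ≟v α
  ... | yes refl = refl
  ... | no x≢α   = squares-balance A (F x) (F c) (F d) (*-≢0 c∈S d∈S)
      (pair-balance c∈S c≢α x∈S d∈S (sym (⊕-exchange (sym c⊕d≡α⊕β))) x≢α (≢-sym c≢β))
      (pair-balance d∈S d≢α x∈S c∈S (sym (⊕-exchange (trans (sym c⊕d≡α⊕β) (⊕-comm c d)))) x≢α x≢d)
    where
    open SecondPair (second-pair x∈S x≢α)
    x≢d : ¬ x ≡ d
    x≢d x≡d = ⊕-≢ʳ c≢α (sym x≡d)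

  F≡±A : ∀ x → InSupport f x → F x ≡ A ⊎ F x ≡ - A
  F≡±A x x∈S = x²≡a²⇒x≡±a (F x) A (F²≡A² x x∈S)

  S⁺ : List (F2^ n)
  S⁺ = filter (λ x → F x ℤ.≟ A) S

  L : List (F2^ n)
  L = filter (λ x → ¬? (x ≟v α)) S⁺

  ∈L⁻ : ∀ {x} → x ∈ L → InSupport f x × F x ≡ A × ¬ x ≡ α
  ∈L⁻ x∈L with ∈-filter⁻ (λ x → ¬? (x ≟v α)) {xs = S⁺} x∈L
  ... | x∈S⁺ , x≢α with ∈-filter⁻ (λ x → F x ℤ.≟ A) {xs = S} x∈S⁺
  ... | x∈S , Fx≡A = ∈S⁻ x∈S , Fx≡A , x≢α

  ∈L⁺ : ∀ {x} → InSupport f x → F x ≡ A → ¬ x ≡ α → x ∈ L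
  ∈L⁺ x∈S Fx≡A x≢α = ∈-filter⁺ (λ x → ¬? (x ≟v α)) (∈-filter⁺ (λ x → F x ℤ.≟ A) (∈S⁺ x∈S) Fx≡A) x≢α

  -- R x y: y ≠ x lies in the pair {y, y ⊕ α ⊕ x} of O_{α⊕x}
  R : F2^ n → F2^ n → Set
  R x y = ¬ y ≡ x × InSupport f (y ⊕ (α ⊕ x))

  -- For x ∈ L exactly one element of the second pair {c, d} of O_{α⊕x} is in L, since F c F d = - A².
  module _ {x} (x∈L : x ∈ L) where
    private
      x∈S = proj₁ (∈L⁻ x∈L)
      x≢α = proj₂ (proj₂ (∈L⁻ x∈L))
    open SecondPair (second-pair x∈S x≢α)

    FcFd≡-A² : F c * F d ≡ - (A * A)
    FcFd≡-A² = +≡0⇒≡- (F c * F d) (A * A) (begin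
      F c * F d + A * A    ≡⟨ ℤ.+-comm (F c * F d) (A * A) ⟩
      A * A + F c * F d    ≡⟨ cong (λ t → A * t + F c * F d) (sym (proj₁ (proj₂ (∈L⁻ x∈L)))) ⟩
      A * F x + F c * F d  ≡⟨ balance ⟩
      + 0                  ∎)

    not-both-in-L : F c ≡ A → F d ≡ A → ⊥
    not-both-in-L Fc≡A Fd≡A = *-≢0 α∈S α∈S (t+t≡0⇒t≡0 (A * A) (begin
      A * A + A * A          ≡⟨ cong (_+_ (A * A)) (trans (cong₂ _*_ (sym Fc≡A) (sym Fd≡A)) FcFd≡-A²) ⟩
      A * A + - (A * A)      ≡⟨ ℤ.+-inverseʳ (A * A) ⟩
      + 0                    ∎))

    L-partner : ∃ λ y → y ∈ L × R x y
    L-partner = choose (F≡±A c c∈S)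
      where
      choose : F c ≡ A ⊎ F c ≡ - A → ∃ λ y → y ∈ L × R x y
      choose (inj₁ Fc≡A)  = c , ∈L⁺ c∈S Fc≡A c≢α , c≢β , d∈S
      choose (inj₂ Fc≡-A) = d , ∈L⁺ d∈S Fd≡A d≢α , d≢β , subst (InSupport f) (sym (⊕-cancelʳ c (α ⊕ x))) c∈S
        where
        Fd≡A : F d ≡ A
        Fd≡A = ℤ.*-cancelˡ-≡ A (F d) A {{ℤ.≢-nonZero α∈S}} (ℤ.neg-injective (begin
          - (A * F d)     ≡⟨ ℤ.neg-distribˡ-* A (F d) ⟩
          - A * F d       ≡⟨ cong (_* F d) (sym Fc≡-A) ⟩
          F c * F d       ≡⟨ FcFd≡-A² ⟩
          - (A * A)       ∎))

    R-in-second-pair : ∀ {y} → y ∈ L → R x y → y ≡ c ⊎ y ≡ d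
    R-in-second-pair {y} y∈L (y≢x , yγ∈S) with only y (*-≢0 (proj₁ (∈L⁻ y∈L)) yγ∈S)
    ... | here y≡α                          = ⊥-elim (proj₂ (proj₂ (∈L⁻ y∈L)) y≡α)
    ... | there (here y≡x)                  = ⊥-elim (y≢x y≡x)
    ... | there (there (here y≡c))          = inj₁ y≡c
    ... | there (there (there (here y≡d)))  = inj₂ y≡d

  L-matching : PerfectMatching _≟v_ R L
  L-matching = record
    { partner     = L-partner
    ; functional  = functional
    ; symmetric   = λ {x} {y} _ _ (y≢x , yγ∈S) → ≢-sym y≢x , subst (InSupport f) (⊕-rotate x α y) yγ∈S
    ; irreflexive = λ Rxx → proj₁ Rxx refl
    }
    where
    F≡A : ∀ {y} → y ∈ L → F y ≡ A
    F≡A y∈L = proj₁ (proj₂ (∈L⁻ y∈L))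
    functional : ∀ {x y y′} → x ∈ L → y ∈ L → y′ ∈ L → R x y → R x y′ → y ≡ y′
    functional x∈L y∈L y′∈L Rxy Rxy′ with R-in-second-pair x∈L y∈L Rxy | R-in-second-pair x∈L y′∈L Rxy′
    ... | inj₁ y≡c | inj₁ y′≡c = trans y≡c (sym y′≡c)
    ... | inj₂ y≡d | inj₂ y′≡d = trans y≡d (sym y′≡d)
    ... | inj₁ refl | inj₂ refl = ⊥-elim (not-both-in-L x∈L (F≡A y∈L) (F≡A y′∈L))
    ... | inj₂ refl | inj₁ refl = ⊥-elim (not-both-in-L x∈L (F≡A y′∈L) (F≡A y∈L))

  S⁺-odd : ∃ λ q → length S⁺ ≡ suc (q ℕ.+ q)
  S⁺-odd = q , trans ∣S⁺∣≡1+∣L∣ (cong suc L-even)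
    where
    L-unique = Unique.filter⁺ _ (Unique.filter⁺ _ S-unique)
    q = proj₁ (even-length _≟v_ L L-unique L-matching)
    L-even = proj₂ (even-length _≟v_ L L-unique L-matching)
    ∣S⁺∣≡1+∣L∣ = length-filter-≢ _≟v_ S⁺ (Unique.filter⁺ _ S-unique) (∈-filter⁺ _ (∈S⁺ α∈S) refl)

  parseval : + sparsity f * (A * A) ≡ pow2 n * pow2 n
  parseval = begin
    + sparsity f * (A * A)            ≡⟨ sym (∑-const S (A * A)) ⟩
    ∑ S (λ _ → A * A)                 ≡⟨ sym (∑-cong-∈ S (λ {y} y∈S → F²≡A² y (∈S⁻ y∈S))) ⟩
    ∑ S (λ y → F y * F y)             ≡⟨ sym (∑-support _ (λ y Fy≡0 → cong (_* F y) Fy≡0)) ⟩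
    ∑ V (λ y → F y * F y)             ≡⟨ ∑-cong V (λ y → cong (λ t → F y * F t) (sym (⊕-identityʳ y))) ⟩
    ∑ V (λ y → F y * F (y ⊕ 0ᵛ))      ≡⟨ autocorrelation f f²≡1 0ᵛ ⟩
    pow2 n * δ₀ (0ᵛ {n})              ≡⟨ cong (pow2 n *_) (δ₀-0ᵛ n) ⟩
    pow2 n * pow2 n                   ∎

  sparsity≤4 : sparsity f ≤ 4
  sparsity≤4 = k≤4 n k q A σ (f 0ᵛ) α∈S (f²≡1 0ᵛ) Aσ≡2ⁿf0 parseval σ+k≡4q+2
    where
    k = sparsity f
    q = proj₁ S⁺-odd
    σ = + 2 * + length S⁺ - + k
    Aσ≡2ⁿf0 : A * σ ≡ pow2 n * f 0ᵛ
    Aσ≡2ⁿf0 = trans (sym ∑S≡Aσ) (trans (sym ∑V≡∑S) (fourier-inversion f))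
      where
      ∑S≡Aσ : ∑ S F ≡ A * σ
      ∑S≡Aσ = ∑-±value S F A (λ {x} x∈S → F≡±A x (∈S⁻ x∈S))
      ∑V≡∑S : ∑ V F ≡ ∑ S F
      ∑V≡∑S = ∑-support F (λ _ Fx≡0 → Fx≡0)
    σ+k≡4q+2 : σ + + k ≡ + 4 * + q + + 2
    σ+k≡4q+2 = begin
      + 2 * + length S⁺ - + k + + k
        ≡⟨ cong (λ l → + 2 * + l - + k + + k) (proj₂ S⁺-odd) ⟩
      + 2 * + suc (q ℕ.+ q) - + k + + k
        ≡⟨ cong (λ l → + 2 * l - + k + + k) (trans (ℤ.pos-+ 1 (q ℕ.+ q)) (cong (_+_ (+ 1)) (ℤ.pos-+ q q))) ⟩
      + 2 * (+ 1 + (+ q + + q)) - + k + + k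
        ≡⟨ lemma (+ k) (+ q) ⟩
      + 4 * + q + + 2 ∎
      where lemma : ∀ k q → + 2 * (+ 1 + (q + q)) - k + k ≡ + 4 * q + + 2
            lemma = solve-∀

±1⇒²≡1 : ∀ {x} → x ≡ + 1 ⊎ x ≡ -[1+ 0 ] → x * x ≡ + 1
±1⇒²≡1 (inj₁ refl) = refl
±1⇒²≡1 (inj₂ refl) = refl

theorem3 : (n : ℕ) (f : F2^ n → ℤ)
    → (∀ x → f x ≡ + 1 ⊎ f x ≡ -[1+ 0 ])
    → 4 < sparsity f
    → (α : F2^ n) → InSupport f α
    → Σ (F2^ n) (λ β → InSupport f β × ¬ (β ≡ α) × 3 ≤ O-size f (α ⊕ β))
theorem3 n f f≡±1 4<k α α∈S
  with search (λ β → ¬? (scaledCoeff f β ℤ.≟ + 0) ×-dec ¬? (β ≟v α) ×-dec (3 ℕ.≤? O-size f (α ⊕ β)))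
... | inj₁ β = β
... | inj₂ none = contradiction (BoundedO.sparsity≤4 f (±1⇒²≡1 ∘ f≡±1) α α∈S O≤2) (ℕ.<⇒≱ 4<k)
  where
  O≤2 : ∀ β → InSupport f β → ¬ β ≡ α → O-size f (α ⊕ β) ≤ 2
  O≤2 β β∈S β≢α = ℕ.≤-pred (ℕ.≰⇒> (λ 3≤O → none β (β∈S , β≢α , 3≤O)))
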